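{- Let $T$ be a plane tree of the form $\mathcal{T}(w)$ for a word $w$ of length $n$, and let $1\le k\le n-1$. If the $k$-th and $(k+1)$-th sectors of $T$ are not attached to the same vertex, then $d_k(\mathcal{M}_T)=0$. If they are attached to the same vertex, then $d_k(\mathcal{M}_T)=\mathcal{M}_{T'}$, where $T'$ is obtained from $T$ by gluing the $k$-th and $(k+1)$-th sectors (i.e. deleting the leaf lying between these two consecutive sectors at that vertex).
   Context: Let $A=\{a_1<a_2<\cdots\}$ be an infinite totally ordered alphabet (identified with $\{1<2<\cdots\}$) and $\mathbb{K}$ a field; work with formal $\mathbb{K}$-linear combinations of words over $A$. For a word $w$ with distinct letters $b_1<\dots<b_r$, $\mathrm{pack}(w)$ is the image of $w$ under $b_i\mapsto i$; $w$ is packed if $\mathrm{pack}(w)=w$; $\mathbf{M}_u=\sum_{\mathrm{pack}(w)=u}w$. The linear operator $d_k$ is defined on words by $d_k(w)=uav$ if $w=uaav$ with $a$ a letter and $|u|=k-1$, and $d_k(w)=0$ otherwise. With every word $w$ associate a plane tree $\mathcal{T}(w)$: $\mathcal{T}(\varepsilon)$ is a single leaf; otherwise, if $m=\max(w)$ occurs exactly $j-1$ times, write $w=v_1mv_2\cdots v_{j-1}mv_j$ and let $\mathcal{T}(w)$ be the tree whose root has the $j$ subtrees $\mathcal{T}(v_1),\dots,\mathcal{T}(v_j)$ in this order (so $\mathcal{T}(w)$ has $|w|+1$ leaves). The gaps between two consecutive children of an internal vertex are called sectors; the sectors of $\mathcal{T}(w)$ are ordered from left to right recursively (the sectors of $\mathcal{T}(v_1)$,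 then the first root sector, then the sectors of $\mathcal{T}(v_2)$, etc.), so that the $i$-th sector corresponds to the letter $w_i$. For a plane tree $T$, $\mathcal{M}_T=\sum_{u\text{ packed},\ \mathcal{T}(u)=T}\mathbf{M}_u$. -}

module Defs where

open import Level using (Level; _⊔_) renaming (suc to lsuc)
open import Data.Nat using (ℕ; zero; suc; _<_; _∸_; _≟_) renaming (_⊔_ to _⊔ℕ_)
open import Data.Nat.Properties using (_<?_)
open import Data.Bool using (Bool; true; false; _∧_; if_then_else_)
open import Data.List using (List; []; _∷_; _++_; map; length; filter; foldr; concatMap; upTo)
open import Data.List.Properties using (≡-dec)
open import Data.List.Relation.Unary.Any using (any?)
open import Data.Maybe using (Maybe; just; nothing)
open import Data.Product using (Σ; _×_; _,_; proj₁; proj₂; ∃-syntax)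
open import Relation.Nullary using (¬_; Dec; yes; no)
open import Relation.Nullary.Decidable using (⌊_⌋)
open import Relation.Binary.PropositionalEquality using (_≡_)
open import Algebra.Bundles using (CommutativeRing)

record Field (c ℓ : Level) : Set (lsuc (c ⊔ ℓ)) where
  field
    commutativeRing : CommutativeRing c ℓ
  open CommutativeRing commutativeRing public
  field
    1≉0     : ¬ (1# ≈ 0#)
    inverse : ∀ x → ¬ (x ≈ 0#) → ∃[ y ] (x * y ≈ 1#)

-- Words.  The alphabet A is ℕ with its usual order (an infinite totally
-- ordered alphabet; packed words use the letters 1..r).

Letter : Set
Letter = ℕ

Word : Set
Word = List Letter

_≟w_ : (u v : Word) → Dec (u ≡ v)
_≟w_ = ≡-dec _≟_

_==w_ : Word → Word → Bool
u ==w v = ⌊ u ≟w v ⌋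

occurs : Letter → Word → Bool
occurs a w = ⌊ any? (λ b → a ≟ b) w ⌋

-- pack(w): the letter a of w is sent to i when a is the i-th smallest
-- distinct letter of w, i.e. i = 1 + #{ b < a : b occurs in w }.
pack : Word → Word
pack w = map (λ a → suc (length (filter (λ b → Data.Bool._≟_ (occurs b w) true) (upTo a)))) w

isPacked : Word → Bool
isPacked w = pack w ==w w

maxW : Word → ℕ
maxW = foldr _⊔ℕ_ 0

allWords : List Letter → ℕ → List Word
allWords as zero    = [] ∷ []
allWords as (suc n) = concatMap (λ a → map (a ∷_) (allWords as n)) as

-- d_k on words: d_k(u a a v) = u a v when |u| = k - 1, otherwise 0
-- (represented by nothing).  k ≥ 1; d_0 is identically 0.
dWord : ℕ → Word → Maybe Word
dWord zero          w           = nothing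
dWord (suc zero)    []          = nothing
dWord (suc zero)    (a ∷ [])    = nothing
dWord (suc zero)    (a ∷ b ∷ v) with a ≟ b
... | yes _ = just (a ∷ v)
... | no  _ = nothing
dWord (suc (suc k)) []          = nothing
dWord (suc (suc k)) (a ∷ w) with dWord (suc k) w
... | just v  = just (a ∷ v)
... | nothing = nothing

isJust≡ : Maybe Word → Word → Bool
isJust≡ (just u) v = u ==w v
isJust≡ nothing  v = false

data Tree : Set where
  node : List Tree → Tree

leaf : Tree
leaf = node []

mutual
  _==t_ : Tree → Tree → Bool
  node ts ==t node ss = ts ==ts ss

  _==ts_ : List Tree → List Tree → Bool
  []       ==ts []       = true
  []       ==ts (_ ∷ _)  = false
  (_ ∷ _)  ==ts []       = false
  (t ∷ ts) ==ts (s ∷ ss) = (t ==t s) ∧ (ts ==ts ss)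

mutual
  leaves : Tree → ℕ
  leaves (node []) = 1
  leaves (node (t ∷ ts)) = leavesL (t ∷ ts)

  leavesL : List Tree → ℕ
  leavesL []       = 0
  leavesL (t ∷ ts) = leaves t Data.Nat.+ leavesL ts

consHead : Letter → List Word → List Word
consHead x []       = (x ∷ []) ∷ []
consHead x (v ∷ vs) = (x ∷ v) ∷ vs

splitAt-m : Letter → Word → List Word
splitAt-m m []       = [] ∷ []
splitAt-m m (x ∷ xs) with x ≟ m
... | yes _ = [] ∷ splitAt-m m xs
... | no  _ = consHead x (splitAt-m m xs)

-- 𝒯 with fuel (fuel = length of the word, which strictly decreases)
treeFuel : ℕ → Word → Tree
treeFuel zero    w       = leaf
treeFuel (suc n) []      = leaf
treeFuel (suc n) (a ∷ w) = node (map (treeFuel n) (splitAt-m (maxW (a ∷ w)) (a ∷ w)))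

𝒯 : Word → Tree
𝒯 w = treeFuel (length w) w

-- A vertex is addressed by its path from the root (list of
-- 0-based child indices); a sector is (vertex, i), the gap between the
-- i-th and (i+1)-th children (0-based) of that vertex.  Sectors are listed
-- left to right: sectors of child 0, gap 0, sectors of child 1, gap 1, …

Vertex : Set
Vertex = List ℕ

Sector : Set
Sector = Vertex × ℕ

prefixS : ℕ → List Sector → List Sector
prefixS j = map (λ s → (j ∷ proj₁ s , proj₂ s))

mutual
  sectors : Tree → List Sector
  sectors (node [])       = []
  sectors (node (t ∷ ts)) = prefixS 0 (sectors t) ++ sectorsFrom 0 ts

  -- i = index of the child preceding the list ts
  sectorsFrom : ℕ → List Tree → List Sector
  sectorsFrom i []       = []
  sectorsFrom i (t ∷ ts) = ([] , i) ∷ prefixS (suc i) (sectors t) ++ sectorsFrom (suc i) ts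

-- k-th element of a list, 1-based
nth : {A : Set} → List A → ℕ → Maybe A
nth xs       zero          = nothing
nth []       (suc k)       = nothing
nth (x ∷ xs) (suc zero)    = just x
nth (x ∷ xs) (suc (suc k)) = nth xs (suc k)

SameVertex : Tree → ℕ → Set
SameVertex T k = Σ Vertex λ p → Σ ℕ λ i → Σ ℕ λ j →
  (nth (sectors T) k ≡ just (p , i)) × (nth (sectors T) (suc k) ≡ just (p , j))

-- delete the m-th (0-based) element of a list
removeAt : {A : Set} → ℕ → List A → List A
removeAt m       []       = []
removeAt zero    (x ∷ xs) = xs
removeAt (suc m) (x ∷ xs) = x ∷ removeAt m xs

mutual
  deleteChild : Vertex → ℕ → Tree → Tree
  deleteChild []      m (node ts) = node (removeAt m ts)
  deleteChild (j ∷ p) m (node ts) = node (deleteChildIn j p m ts)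

  deleteChildIn : ℕ → Vertex → ℕ → List Tree → List Tree
  deleteChildIn j       p m []       = []
  deleteChildIn zero    p m (t ∷ ts) = deleteChild p m t ∷ ts
  deleteChildIn (suc j) p m (t ∷ ts) = t ∷ deleteChildIn j p m ts

-- gluing the k-th and (k+1)-th sectors: if the k-th sector is the gap i
-- at vertex p, delete the child i+1 of p (the leaf lying between the gap
-- i and the gap i+1 at p).
glue : Tree → ℕ → Tree
glue T k with nth (sectors T) k
... | just (p , i) = deleteChild p (suc i) T
... | nothing      = T

-- Formal (possibly infinite) K-linear combinations of words: a series
-- is its coefficient function.

module Series {c ℓ : Level} (K : Field c ℓ) where
  open Field K

  Ser : Set c
  Ser = Word → Carrier

  _≈S_ : Ser → Ser → Set ℓ
  f ≈S g = ∀ w → f w ≈ g w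

  0S : Ser
  0S w = 0#

  Σ[_]_ : {A : Set} → List A → (A → Carrier) → Carrier
  Σ[ xs ] f = foldr (λ x r → f x + r) 0# xs

  𝐌 : Word → Ser
  𝐌 u w = if pack w ==w u then 1# else 0#

  -- packed u with 𝒯(u) = T have length n = leaves(T) - 1 and letters in
  -- {1..n}, so the sum defining ℳ_T ranges over a finite set.
  ℳ : Tree → Ser
  ℳ T w = Σ[ allWords (upTo (suc n)) n ] (λ u →
            if isPacked u ∧ (𝒯 u ==t T) then 𝐌 u w else 0#)
    where n = leaves T ∸ 1

  -- d_k extended linearly: the coefficient of v in d_k(f) is the sum of the
  -- coefficients f(w) over all w with d_k(w) = v; such w have length |v|+1
  -- and letters among those of v (hence ≤ max v), a finite set.
  d : ℕ → Ser → Ser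
  d k f v = Σ[ allWords (upTo (suc (maxW v))) (suc (length v)) ] (λ w →
              if isJust≡ (dWord k w) v then f w else 0#)

-- The coefficient of a word v in d_k(f) is the coefficient in f of the word obtained from v by
-- doubling its k-th letter (and 0 if v is too short).  Doubling a letter commutes with packing, and
-- on trees it inserts a new leaf right after the k-th sector, so the k-th and (k+1)-th sectors of
-- the result share a vertex and gluing them undoes the insertion; conversely, two consecutive
-- sectors of 𝒯(w) share a vertex only if the letters w_k and w_{k+1} are equal.  Hence the packed
-- words of shape T with a doubled k-th letter are exactly the doublings of the packed words of
-- shape glue T k, and there are none when the two sectors lie at different vertices.

module Submission where

open import Defs
open import Level using (Level)
open import Function using (_∘_; _⇔_; mk⇔; Equivalence)
open import Data.Bool as Bool using (Bool; true; false; _∧_; if_then_else_)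
open import Data.Empty using (⊥; ⊥-elim)
open import Data.Unit using (⊤; tt)
open import Data.Nat as ℕ using (ℕ; zero; suc; _+_; _∸_; _≤_; _<_; z≤n; s≤s; _≟_; _⊔_)
open import Data.Nat.Properties
  using (+-suc; +-identityʳ; ≤-trans; ≤-refl; ≤-pred; <-irrefl; m≤n⇒m≤1+n; suc-injective; ≰⇒>;
         ⊔-sel; m≤m⊔n; m≤n⊔m; ⊔-idem; ⊔-assoc; ⊔-identityʳ)
open import Data.List using (List; []; _∷_; _++_; map; length; filter; upTo; concatMap)
open import Data.List.Properties
  using (++-assoc; length-++; length-map; map-++; map-cong; map-cong-local; ++-identityʳ;
         ∷-injectiveˡ; ∷-injectiveʳ; filter-≐)
open import Data.List.Relation.Unary.All as All using (All; []; _∷_)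
open import Data.List.Relation.Unary.All.Properties using (++⁺) renaming (map⁺ to All-map⁺)
open import Data.List.Relation.Unary.Any using (Any; here; there; any?)
open import Data.List.Relation.Unary.AllPairs using (_∷_)
open import Data.List.Relation.Unary.Unique.Propositional using (Unique)
open import Data.List.Relation.Unary.Unique.Propositional.Properties using (filter⁺; upTo⁺)
open import Data.List.Membership.Propositional using (_∈_)
open import Data.List.Membership.Propositional.Properties using (∈-∃++; ∈-filter⁻; ∈-upTo⁺; ∈-upTo⁻)
open import Data.Maybe as Maybe using (Maybe; just; nothing)
open import Data.Product as Product using (Σ; ∃-syntax; _×_; _,_; proj₁; proj₂; uncurry′)
open import Data.Sum using (_⊎_; inj₁; inj₂)
open import Relation.Nullary using (¬_; Dec; yes; no)
open import Relation.Nullary.Decidable using (⌊_⌋; isYes≗does; does-⇔; dec-true; dec-false)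
open import Relation.Binary.PropositionalEquality
  using (_≡_; _≢_; _≗_; refl; sym; trans; cong; cong₂; subst; subst₂; module ≡-Reasoning)

-- Lists

module _ {A : Set} where

  nth-++ʳ : (xs ys : List A) (k : ℕ) → nth (xs ++ ys) (length xs + suc k) ≡ nth ys (suc k)
  nth-++ʳ []       ys k = refl
  nth-++ʳ (x ∷ xs) ys k = begin
    nth (x ∷ xs ++ ys) (suc (length xs + suc k))   ≡⟨ cong (nth (x ∷ xs ++ ys) ∘ suc) (+-suc (length xs) k) ⟩
    nth (xs ++ ys) (suc (length xs + k))           ≡⟨ cong (nth (xs ++ ys)) (sym (+-suc (length xs) k)) ⟩
    nth (xs ++ ys) (length xs + suc k)             ≡⟨ nth-++ʳ xs ys k ⟩
    nth ys (suc k)                                 ∎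
    where open ≡-Reasoning

  nth-++ˡ : (xs ys : List A) (k : ℕ) {x : A} → nth xs k ≡ just x → nth (xs ++ ys) k ≡ just x
  nth-++ˡ (x ∷ xs) ys (suc zero)    eq = eq
  nth-++ˡ (x ∷ xs) ys (suc (suc k)) eq = nth-++ˡ xs ys (suc k) eq

  nth-++-view : (xs ys : List A) (k : ℕ) →
    (nth (xs ++ ys) (suc k) ≡ nth xs (suc k)) ⊎
    (∃[ k′ ] (suc k ≡ length xs + suc k′) × (nth (xs ++ ys) (suc k) ≡ nth ys (suc k′)))
  nth-++-view []       ys k       = inj₂ (k , refl , refl)
  nth-++-view (x ∷ xs) ys zero    = inj₁ refl
  nth-++-view (x ∷ xs) ys (suc k) with nth-++-view xs ys k
  ... | inj₁ eq              = inj₁ eq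
  ... | inj₂ (k′ , ix , eq) = inj₂ (k′ , cong suc ix , eq)

  nth-++-∷ : (xs : List A) (y : A) (ys : List A) → nth (xs ++ y ∷ ys) (suc (length xs)) ≡ just y
  nth-++-∷ []       y ys = refl
  nth-++-∷ (x ∷ xs) y ys = nth-++-∷ xs y ys

  nth-++-∷-∷ : (xs : List A) (y y′ : A) (ys : List A) →
    nth (xs ++ y ∷ y′ ∷ ys) (suc (suc (length xs))) ≡ just y′
  nth-++-∷-∷ []       y y′ ys = refl
  nth-++-∷-∷ (x ∷ xs) y y′ ys = nth-++-∷-∷ xs y y′ ys

  nth-All : {P : A → Set} {xs : List A} (k : ℕ) {x : A} → All P xs → nth xs k ≡ just x → P x
  nth-All (suc zero)    (px ∷ _)   refl = px
  nth-All (suc (suc k)) (_  ∷ pxs) eq   = nth-All (suc k) pxs eq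

  nth-map : {B : Set} (f : A → B) (xs : List A) (k : ℕ) → nth (map f xs) k ≡ Maybe.map f (nth xs k)
  nth-map f xs       zero          = refl
  nth-map f []       (suc k)       = refl
  nth-map f (x ∷ xs) (suc zero)    = refl
  nth-map f (x ∷ xs) (suc (suc k)) = nth-map f xs (suc k)

  nth-map-just : {B : Set} (f : A → B) (xs : List A) (k : ℕ) {y : B} →
    nth (map f xs) k ≡ just y → ∃[ x ] (nth xs k ≡ just x) × (f x ≡ y)
  nth-map-just f xs k eq with nth xs k | trans (sym (nth-map f xs k)) eq
  ... | just x | refl = x , refl , refl

  length-≤-++-∷ : (xs : List A) (y : A) (ys : List A) → suc (length xs) ≤ length (xs ++ y ∷ ys)
  length-≤-++-∷ []       y ys = s≤s z≤n
  length-≤-++-∷ (x ∷ xs) y ys = s≤s (length-≤-++-∷ xs y ys)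

  length-++-∷-∷ : (xs : List A) (y : A) (ys : List A) → length (xs ++ y ∷ y ∷ ys) ≡ suc (length (xs ++ y ∷ ys))
  length-++-∷-∷ []       y ys = refl
  length-++-∷-∷ (x ∷ xs) y ys = cong suc (length-++-∷-∷ xs y ys)

  ++-∷-injective : (xs xs′ : List A) {y y′ : A} {ys ys′ : List A} →
    xs ++ y ∷ ys ≡ xs′ ++ y′ ∷ ys′ → length xs ≡ length xs′ → (xs ≡ xs′) × (y ≡ y′) × (ys ≡ ys′)
  ++-∷-injective []       []        refl _ = refl , refl , refl
  ++-∷-injective (x ∷ xs) (x′ ∷ xs′) eq len
    with refl ← ∷-injectiveˡ eq
       | refl , refl , refl ← ++-∷-injective xs xs′ (∷-injectiveʳ eq) (suc-injective len)
       = refl , refl , refl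

  splitAt-∷ : ∀ k (xs : List A) → suc k ≤ length xs → ∃[ a ] ∃[ b ] ∃[ c ] (xs ≡ a ++ b ∷ c) × (length a ≡ k)
  splitAt-∷ zero    (x ∷ xs) _        = [] , x , xs , refl , refl
  splitAt-∷ (suc k) (x ∷ xs) (s≤s le) with a , b , c , refl , refl ← splitAt-∷ k xs le = x ∷ a , b , c , refl , refl

  ++-∷-split : (xs R a c : List A) (b : A) → xs ++ R ≡ a ++ b ∷ c →
    (∃[ c′ ] (xs ≡ a ++ b ∷ c′) × (c ≡ c′ ++ R)) ⊎ (∃[ a′ ] (a ≡ xs ++ a′) × (R ≡ a′ ++ b ∷ c))
  ++-∷-split []       R a       c b eq   = inj₂ (a , refl , eq)
  ++-∷-split (x ∷ xs) R []      c b refl = inj₁ (xs , refl , refl)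
  ++-∷-split (x ∷ xs) R (y ∷ a) c b eq with refl ← ∷-injectiveˡ eq
    with ++-∷-split xs R a c b (∷-injectiveʳ eq)
  ... | inj₁ (c′ , refl , refl) = inj₁ (c′ , refl , refl)
  ... | inj₂ (a′ , refl , refl) = inj₂ (a′ , refl , refl)

-- Splitting a word at its maximal letter

Avoids : Letter → Word → Set
Avoids m = All (_≢ m)

splitOn : Letter → Word → Word × List Word
splitOn m []       = [] , []
splitOn m (x ∷ xs) with x ≟ m
... | yes _ = [] , uncurry′ _∷_ (splitOn m xs)
... | no  _ = Product.map₁ (x ∷_) (splitOn m xs)

joinOn : Letter → Word → List Word → Word
joinOn m v []       = v
joinOn m v (u ∷ us) = v ++ m ∷ joinOn m u us

joinTail : Letter → List Word → Word
joinTail m []       = []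
joinTail m (u ∷ us) = m ∷ joinOn m u us

joinOn≡++joinTail : ∀ m v vs → joinOn m v vs ≡ v ++ joinTail m vs
joinOn≡++joinTail m v []       = sym (++-identityʳ v)
joinOn≡++joinTail m v (u ∷ us) = refl

joinOn-∷ : ∀ m x v vs → joinOn m (x ∷ v) vs ≡ x ∷ joinOn m v vs
joinOn-∷ m x v []       = refl
joinOn-∷ m x v (u ∷ us) = refl

splitAt-m≡splitOn : ∀ m y → splitAt-m m y ≡ uncurry′ _∷_ (splitOn m y)
splitAt-m≡splitOn m []       = refl
splitAt-m≡splitOn m (x ∷ xs) with x ≟ m
... | yes _ = cong ([] ∷_) (splitAt-m≡splitOn m xs)
... | no  _ rewrite splitAt-m≡splitOn m xs = refl

joinOn-splitOn : ∀ m y → uncurry′ (joinOn m) (splitOn m y) ≡ y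
joinOn-splitOn m []       = refl
joinOn-splitOn m (x ∷ xs) with x ≟ m
... | yes refl = cong (x ∷_) (joinOn-splitOn m xs)
... | no  _    = trans (joinOn-∷ m x _ (proj₂ (splitOn m xs))) (cong (x ∷_) (joinOn-splitOn m xs))

splitOn-joinOn : ∀ m v vs → Avoids m v → All (Avoids m) vs → splitOn m (joinOn m v vs) ≡ (v , vs)
splitOn-joinOn m []      []       _          _          = refl
splitOn-joinOn m []      (u ∷ us) _          (nu ∷ nus) with m ≟ m
... | yes _  rewrite splitOn-joinOn m u us nu nus = refl
... | no m≢m = ⊥-elim (m≢m refl)
splitOn-joinOn m (x ∷ v) vs      (x≢m ∷ nv) nvs rewrite joinOn-∷ m x v vs with x ≟ m
... | yes x≡m = ⊥-elim (x≢m x≡m)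
... | no  _   rewrite splitOn-joinOn m v vs nv nvs = refl

splitOn-avoids : ∀ m y → Avoids m (proj₁ (splitOn m y)) × All (Avoids m) (proj₂ (splitOn m y))
splitOn-avoids m []       = [] , []
splitOn-avoids m (x ∷ xs) with x ≟ m | splitOn-avoids m xs
... | yes _   | nv , nvs = [] , nv ∷ nvs
... | no  x≢m | nv , nvs = x≢m ∷ nv , nvs

blocks≤ : ∀ m y → All (λ u → length u ≤ length y) (uncurry′ _∷_ (splitOn m y))
blocks≤ m []       = z≤n ∷ []
blocks≤ m (x ∷ xs) with x ≟ m | blocks≤ m xs
... | yes _ | ih     = z≤n ∷ All.map m≤n⇒m≤1+n ih
... | no  _ | p ∷ ps = s≤s p ∷ All.map m≤n⇒m≤1+n ps

blocks< : ∀ m y → m ∈ y → All (λ u → length u < length y) (uncurry′ _∷_ (splitOn m y))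
blocks< m (x ∷ xs) m∈ with x ≟ m
... | yes _ = s≤s z≤n ∷ All.map s≤s (blocks≤ m xs)
blocks< m (x ∷ xs) (here m≡x)  | no x≢m = ⊥-elim (x≢m (sym m≡x))
blocks< m (x ∷ xs) (there m∈) | no _ with blocks< m xs m∈
... | p ∷ ps = s≤s p ∷ All.map m≤n⇒m≤1+n ps

maxW-∈ : ∀ x xs → maxW (x ∷ xs) ∈ x ∷ xs
maxW-∈ x []       = here (⊔-identityʳ x)
maxW-∈ x (y ∷ ys) with ⊔-sel x (maxW (y ∷ ys))
... | inj₁ eq = here eq
... | inj₂ eq = there (subst (_∈ y ∷ ys) (sym eq) (maxW-∈ y ys))

maxW-ub : ∀ y → All (_≤ maxW y) y
maxW-ub []       = []
maxW-ub (x ∷ xs) = m≤m⊔n x (maxW xs) ∷ All.map (λ le → ≤-trans le (m≤n⊔m x (maxW xs))) (maxW-ub xs)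

maxW-++-∷-∷ : ∀ a b c → maxW (a ++ b ∷ b ∷ c) ≡ maxW (a ++ b ∷ c)
maxW-++-∷-∷ []      b c = trans (sym (⊔-assoc b b (maxW c))) (cong (_⊔ maxW c) (⊔-idem b))
maxW-++-∷-∷ (x ∷ a) b c = cong (x ⊔_) (maxW-++-∷-∷ a b c)

maxBlocks : Word → Word × List Word
maxBlocks y = splitOn (maxW y) y

𝒯-node : Word → List Word → Tree
𝒯-node v vs = node (𝒯 v ∷ map 𝒯 vs)

maxBlocks< : ∀ x xs → All (λ u → length u < suc (length xs)) (uncurry′ _∷_ (maxBlocks (x ∷ xs)))
maxBlocks< x xs = blocks< (maxW (x ∷ xs)) (x ∷ xs) (maxW-∈ x xs)

treeFuel[] : ∀ f → treeFuel f [] ≡ leaf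
treeFuel[] zero    = refl
treeFuel[] (suc f) = refl

treeFuel-irrelevant : ∀ f g y → length y ≤ f → length y ≤ g → treeFuel f y ≡ treeFuel g y
treeFuel-irrelevant f       g       []       _       _       = trans (treeFuel[] f) (sym (treeFuel[] g))
treeFuel-irrelevant (suc f) (suc g) (x ∷ xs) (s≤s p) (s≤s q)
  rewrite splitAt-m≡splitOn (maxW (x ∷ xs)) (x ∷ xs) =
  cong node (map-cong-local (All.map (λ lt → treeFuel-irrelevant f g _ (≤-trans (≤-pred lt) p) (≤-trans (≤-pred lt) q))
                                     (maxBlocks< x xs)))

𝒯-unfold : ∀ x xs → 𝒯 (x ∷ xs) ≡ uncurry′ 𝒯-node (maxBlocks (x ∷ xs))
𝒯-unfold x xs rewrite splitAt-m≡splitOn (maxW (x ∷ xs)) (x ∷ xs) =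
  cong node (map-cong-local (All.map (λ lt → treeFuel-irrelevant (length xs) _ _ (≤-pred lt) ≤-refl) (maxBlocks< x xs)))

𝒯-joinOn : ∀ m v vs → Avoids m v → All (Avoids m) vs → joinOn m v vs ≢ [] → maxW (joinOn m v vs) ≡ m →
  𝒯 (joinOn m v vs) ≡ 𝒯-node v vs
𝒯-joinOn m v vs nv nvs nonempty max≡m with joinOn m v vs in eq
... | []     = ⊥-elim (nonempty refl)
... | x ∷ xs = trans (𝒯-unfold x xs)
                     (cong (uncurry′ 𝒯-node) (trans (cong₂ splitOn max≡m (sym eq)) (splitOn-joinOn m v vs nv nvs)))

𝒯-induction : (P : Word → Set) → P [] →
  (∀ x xs → P (proj₁ (maxBlocks (x ∷ xs))) → All P (proj₂ (maxBlocks (x ∷ xs))) → P (x ∷ xs)) →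
  ∀ y → P y
𝒯-induction P base step y = go (suc (length y)) y ≤-refl
  where
  go : ∀ n y → length y < n → P y
  go n       []       _        = base
  go (suc n) (x ∷ xs) (s≤s lt) = step x xs (All.head ih) (All.tail ih)
    where
    ih : All P (uncurry′ _∷_ (maxBlocks (x ∷ xs)))
    ih = All.map (λ lt′ → go n _ (≤-trans lt′ lt)) (maxBlocks< x xs)

-- Sectors of plane trees

shiftSector : Sector → Sector
shiftSector ([]    , i) = [] , suc i
shiftSector (j ∷ p , i) = suc j ∷ p , i

nextSector : Sector → Sector
nextSector (p , i) = p , suc i

underFirstChild : Sector → Sector
underFirstChild (p , i) = 0 ∷ p , i

StartsWith0 : Vertex → Set
StartsWith0 (zero ∷ _) = ⊤
StartsWith0 _          = ⊥

insertAt : ℕ → Tree → List Tree → List Tree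
insertAt zero    t ts       = t ∷ ts
insertAt (suc n) t []       = []
insertAt (suc n) t (s ∷ ss) = s ∷ insertAt n t ss

mutual
  insertChild : Vertex → ℕ → Tree → Tree
  insertChild []      m (node ts) = node (insertAt m leaf ts)
  insertChild (j ∷ p) m (node ts) = node (insertChildIn j p m ts)

  insertChildIn : ℕ → Vertex → ℕ → List Tree → List Tree
  insertChildIn j       p m []       = []
  insertChildIn zero    p m (t ∷ ts) = insertChild p m t ∷ ts
  insertChildIn (suc j) p m (t ∷ ts) = t ∷ insertChildIn j p m ts

-- The new leaf becomes child i+1 of p, so the gap (p , i) turns into the gaps (p , i) and (p , suc i).
insertLeaf : Sector → Tree → Tree
insertLeaf (p , i) = insertChild p (suc i)

removeAt-insertAt : ∀ m (ts : List Tree) → removeAt m (insertAt m leaf ts) ≡ ts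
removeAt-insertAt zero    ts       = refl
removeAt-insertAt (suc m) []       = refl
removeAt-insertAt (suc m) (t ∷ ts) = cong (t ∷_) (removeAt-insertAt m ts)

mutual
  deleteChild-insertChild : ∀ p m t → deleteChild p m (insertChild p m t) ≡ t
  deleteChild-insertChild []      m (node ts) = cong node (removeAt-insertAt m ts)
  deleteChild-insertChild (j ∷ p) m (node ts) = cong node (deleteChildIn-insertChildIn j p m ts)

  deleteChildIn-insertChildIn : ∀ j p m ts → deleteChildIn j p m (insertChildIn j p m ts) ≡ ts
  deleteChildIn-insertChildIn j       p m []       = refl
  deleteChildIn-insertChildIn zero    p m (t ∷ ts) = cong (_∷ ts) (deleteChild-insertChild p m t)
  deleteChildIn-insertChildIn (suc j) p m (t ∷ ts) = cong (t ∷_) (deleteChildIn-insertChildIn j p m ts)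

mutual
  suc-length-sectors : ∀ t → suc (length (sectors t)) ≡ leaves t
  suc-length-sectors (node [])       = refl
  suc-length-sectors (node (t ∷ ts)) = begin
    suc (length (prefixS 0 (sectors t) ++ sectorsFrom 0 ts))          ≡⟨ cong suc (length-++ (prefixS 0 (sectors t))) ⟩
    suc (length (prefixS 0 (sectors t)) + length (sectorsFrom 0 ts)) ≡⟨ cong (λ n → suc n + _) (length-map _ (sectors t)) ⟩
    suc (length (sectors t)) + length (sectorsFrom 0 ts)              ≡⟨ cong₂ _+_ (suc-length-sectors t) (length-sectorsFrom 0 ts) ⟩
    leaves t + leavesL ts                                              ∎
    where open ≡-Reasoning

  length-sectorsFrom : ∀ i ts → length (sectorsFrom i ts) ≡ leavesL ts
  length-sectorsFrom i []       = refl
  length-sectorsFrom i (t ∷ ts) = begin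
    suc (length (prefixS (suc i) (sectors t) ++ sectorsFrom (suc i) ts))
      ≡⟨ cong suc (length-++ (prefixS (suc i) (sectors t))) ⟩
    suc (length (prefixS (suc i) (sectors t)) + length (sectorsFrom (suc i) ts))
      ≡⟨ cong (λ n → suc n + _) (length-map _ (sectors t)) ⟩
    suc (length (sectors t)) + length (sectorsFrom (suc i) ts)
      ≡⟨ cong₂ _+_ (suc-length-sectors t) (length-sectorsFrom (suc i) ts) ⟩
    leaves t + leavesL ts ∎
    where open ≡-Reasoning

prefixS-suc : ∀ j S → prefixS (suc j) S ≡ map shiftSector (prefixS j S)
prefixS-suc j []      = refl
prefixS-suc j (s ∷ S) = cong (_ ∷_) (prefixS-suc j S)

sectorsFrom-suc : ∀ i ts → sectorsFrom (suc i) ts ≡ map shiftSector (sectorsFrom i ts)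
sectorsFrom-suc i []       = refl
sectorsFrom-suc i (t ∷ ts) = cong (([] , suc i) ∷_) (begin
  prefixS (suc (suc i)) (sectors t) ++ sectorsFrom (suc (suc i)) ts
    ≡⟨ cong₂ _++_ (prefixS-suc (suc i) (sectors t)) (sectorsFrom-suc (suc i) ts) ⟩
  map shiftSector (prefixS (suc i) (sectors t)) ++ map shiftSector (sectorsFrom (suc i) ts)
    ≡⟨ map-++ shiftSector (prefixS (suc i) (sectors t)) _ ⟨
  map shiftSector (prefixS (suc i) (sectors t) ++ sectorsFrom (suc i) ts) ∎)
  where open ≡-Reasoning

sectorsFrom-∷ : ∀ t ts → sectorsFrom 0 (t ∷ ts) ≡ ([] , 0) ∷ map shiftSector (sectors (node (t ∷ ts)))
sectorsFrom-∷ t ts = cong (([] , 0) ∷_) (begin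
  prefixS 1 (sectors t) ++ sectorsFrom 1 ts
    ≡⟨ cong₂ _++_ (prefixS-suc 0 (sectors t)) (sectorsFrom-suc 0 ts) ⟩
  map shiftSector (prefixS 0 (sectors t)) ++ map shiftSector (sectorsFrom 0 ts)
    ≡⟨ map-++ shiftSector (prefixS 0 (sectors t)) _ ⟨
  map shiftSector (prefixS 0 (sectors t) ++ sectorsFrom 0 ts) ∎)
  where open ≡-Reasoning

prefixS-startsWith0 : ∀ S → All (StartsWith0 ∘ proj₁) (prefixS 0 S)
prefixS-startsWith0 []      = []
prefixS-startsWith0 (s ∷ S) = tt ∷ prefixS-startsWith0 S

sectorsFrom-¬startsWith0 : ∀ i ts → All (¬_ ∘ StartsWith0 ∘ proj₁) (sectorsFrom i ts)
sectorsFrom-¬startsWith0 i []       = []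
sectorsFrom-¬startsWith0 i (t ∷ ts) = (λ ()) ∷ ++⁺ (prefix (sectors t)) (sectorsFrom-¬startsWith0 (suc i) ts)
  where
  prefix : ∀ S → All (¬_ ∘ StartsWith0 ∘ proj₁) (prefixS (suc i) S)
  prefix []      = []
  prefix (s ∷ S) = (λ ()) ∷ prefix S

record LeafInsertedAt (T : Tree) (k : ℕ) (T′ : Tree) : Set where
  field
    sector     : Sector
    sector≡    : nth (sectors T) k ≡ just sector
    tree≡      : T′ ≡ insertLeaf sector T
    sector≡′   : nth (sectors T′) k ≡ just sector
    sector+1≡′ : nth (sectors T′) (suc k) ≡ just (nextSector sector)

nth-prefixS-++ : ∀ S R k {s} → nth S k ≡ just s → nth (prefixS 0 S ++ R) k ≡ just (underFirstChild s)
nth-prefixS-++ S R k eq = nth-++ˡ (prefixS 0 S) R k (trans (nth-map _ S k) (cong (Maybe.map underFirstChild) eq))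

leafInsertedAt-head : ∀ {t k t′} ts → LeafInsertedAt t k t′ → LeafInsertedAt (node (t ∷ ts)) k (node (t′ ∷ ts))
leafInsertedAt-head {t} {k} {t′} ts ins = record
  { sector     = underFirstChild sector
  ; sector≡    = nth-prefixS-++ (sectors t) _ k sector≡
  ; tree≡      = cong (λ x → node (x ∷ ts)) tree≡
  ; sector≡′   = nth-prefixS-++ (sectors t′) _ k sector≡′
  ; sector+1≡′ = nth-prefixS-++ (sectors t′) _ (suc k) sector+1≡′
  }
  where open LeafInsertedAt ins

leafInsertedAt-gap : ∀ s t ts → LeafInsertedAt (node (s ∷ t ∷ ts)) (suc (length (sectors s))) (node (s ∷ leaf ∷ t ∷ ts))
leafInsertedAt-gap s t ts = record
  { sector     = [] , 0
  ; sector≡    = subst (λ n → nth (P ++ _) (suc n) ≡ _) lengthP (nth-++-∷ P _ _)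
  ; tree≡      = refl
  ; sector≡′   = subst (λ n → nth (P ++ _) (suc n) ≡ _) lengthP (nth-++-∷ P _ _)
  ; sector+1≡′ = subst (λ n → nth (P ++ _) (suc (suc n)) ≡ _) lengthP (nth-++-∷-∷ P _ _ _)
  }
  where
  P = prefixS 0 (sectors s)
  lengthP : length P ≡ length (sectors s)
  lengthP = length-map _ (sectors s)

nth-sectors-∷-∷ : ∀ s t ts k → nth (sectors (node (s ∷ t ∷ ts))) (length (sectors s) + suc (suc k))
                              ≡ Maybe.map shiftSector (nth (sectors (node (t ∷ ts))) (suc k))
nth-sectors-∷-∷ s t ts k = begin
  nth (P ++ sectorsFrom 0 (t ∷ ts)) (length (sectors s) + suc (suc k))
    ≡⟨ cong₂ (λ R n → nth (P ++ R) (n + suc (suc k))) (sectorsFrom-∷ t ts) (sym (length-map _ (sectors s))) ⟩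
  nth (P ++ ([] , 0) ∷ map shiftSector (sectors (node (t ∷ ts)))) (length P + suc (suc k))
    ≡⟨ nth-++ʳ P _ (suc k) ⟩
  nth (map shiftSector (sectors (node (t ∷ ts)))) (suc k)
    ≡⟨ nth-map shiftSector (sectors (node (t ∷ ts))) (suc k) ⟩
  Maybe.map shiftSector (nth (sectors (node (t ∷ ts))) (suc k)) ∎
  where
  open ≡-Reasoning
  P = prefixS 0 (sectors s)

children : Tree → List Tree
children (node ts) = ts

insertLeaf-shiftSector : ∀ σ s ts → insertLeaf (shiftSector σ) (node (s ∷ ts)) ≡ node (s ∷ children (insertLeaf σ (node ts)))
insertLeaf-shiftSector ([]    , i) s ts = refl
insertLeaf-shiftSector (j ∷ p , i) s ts = refl

nextSector-shiftSector : ∀ σ → nextSector (shiftSector σ) ≡ shiftSector (nextSector σ)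
nextSector-shiftSector ([]    , i) = refl
nextSector-shiftSector (j ∷ p , i) = refl

leafInsertedAt-tail : ∀ s {t ts k t′ ts′} → LeafInsertedAt (node (t ∷ ts)) (suc k) (node (t′ ∷ ts′)) →
  LeafInsertedAt (node (s ∷ t ∷ ts)) (length (sectors s) + suc (suc k)) (node (s ∷ t′ ∷ ts′))
leafInsertedAt-tail s {t} {ts} {k} {t′} {ts′} ins = record
  { sector     = shiftSector sector
  ; sector≡    = trans (nth-sectors-∷-∷ s t ts k) (cong (Maybe.map shiftSector) sector≡)
  ; tree≡      = trans (cong (λ T → node (s ∷ children T)) tree≡) (sym (insertLeaf-shiftSector sector s (t ∷ ts)))
  ; sector≡′   = trans (nth-sectors-∷-∷ s t′ ts′ k) (cong (Maybe.map shiftSector) sector≡′)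
  ; sector+1≡′ = trans (cong (nth (sectors (node (s ∷ t′ ∷ ts′)))) (sym (+-suc (length (sectors s)) (suc (suc k)))))
                  (trans (nth-sectors-∷-∷ s t′ ts′ (suc k))
                    (trans (cong (Maybe.map shiftSector) sector+1≡′) (cong just (sym (nextSector-shiftSector sector)))))
  }
  where open LeafInsertedAt ins

glue-at : ∀ T k {s} → nth (sectors T) k ≡ just s → glue T k ≡ deleteChild (proj₁ s) (suc (proj₂ s)) T
glue-at T k eq with nth (sectors T) k
glue-at T k refl | just _ = refl

glue-leafInserted : ∀ {T k T′} → LeafInsertedAt T k T′ → glue T′ k ≡ T
glue-leafInserted {T} {k} {T′} ins = begin
  glue T′ k                                                            ≡⟨ glue-at T′ k sector≡′ ⟩
  deleteChild (proj₁ sector) (suc (proj₂ sector)) T′                   ≡⟨ cong (deleteChild _ _) tree≡ ⟩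
  deleteChild (proj₁ sector) (suc (proj₂ sector)) (insertLeaf sector T) ≡⟨ deleteChild-insertChild (proj₁ sector) _ T ⟩
  T                                                                    ∎
  where
  open ≡-Reasoning
  open LeafInsertedAt ins

leafInserted⇒sameVertex : ∀ {T k T′} → LeafInsertedAt T k T′ → SameVertex T′ k
leafInserted⇒sameVertex ins = proj₁ sector , proj₂ sector , suc (proj₂ sector) , sector≡′ , sector+1≡′
  where open LeafInsertedAt ins

leafInserted-functional : ∀ {T k T′ T″} → LeafInsertedAt T k T′ → LeafInsertedAt T k T″ → T′ ≡ T″
leafInserted-functional ins₁ ins₂ with trans (sym (LeafInsertedAt.sector≡ ins₁)) (LeafInsertedAt.sector≡ ins₂)
... | refl = trans (LeafInsertedAt.tree≡ ins₁) (sym (LeafInsertedAt.tree≡ ins₂))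

AdjacentAtSameVertex : List Sector → ℕ → Set
AdjacentAtSameVertex S k = Σ Vertex λ p → Σ ℕ λ i → Σ ℕ λ j →
  (nth S k ≡ just (p , i)) × (nth S (suc k) ≡ just (p , j))

sameVertex-∷ : ∀ t ts k → SameVertex (node (t ∷ ts)) k →
  SameVertex t k ⊎ ∃[ k′ ] (k ≡ length (sectors t) + suc k′) × AdjacentAtSameVertex (sectorsFrom 0 ts) (suc k′)
sameVertex-∷ t ts (suc k) (p , i , j , e₁ , e₂) with nth-++-view (prefixS 0 (sectors t)) (sectorsFrom 0 ts) k
... | inj₂ (k′ , ix , eq₁) =
  inj₂ (k′ , trans ix (cong (_+ suc k′) (length-map _ (sectors t))) , p , i , j , trans (sym eq₁) e₁ , trans (sym eq₂) e₂)
  where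
  P = prefixS 0 (sectors t)
  eq₂ : nth (P ++ sectorsFrom 0 ts) (suc (suc k)) ≡ nth (sectorsFrom 0 ts) (suc (suc k′))
  eq₂ = trans (cong (nth (P ++ _)) (trans (cong suc ix) (sym (+-suc (length P) (suc k′))))) (nth-++ʳ P _ (suc k′))
... | inj₁ eq₁ with nth-++-view (prefixS 0 (sectors t)) (sectorsFrom 0 ts) (suc k)
...   | inj₂ (k₂ , _ , eq₂) =
  ⊥-elim (nth-All (suc k₂) (sectorsFrom-¬startsWith0 0 ts) (trans (sym eq₂) e₂)
                  (nth-All (suc k) (prefixS-startsWith0 (sectors t)) (trans (sym eq₁) e₁)))
...   | inj₁ eq₂ with nth-map-just _ (sectors t) (suc k) (trans (sym eq₁) e₁)
                    | nth-map-just _ (sectors t) (suc (suc k)) (trans (sym eq₂) e₂)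
...     | (p₁ , i₁) , r₁ , refl | (p₂ , j₂) , r₂ , refl = inj₁ (p₁ , i₁ , j₂ , r₁ , r₂)

firstSector-atRoot : ∀ S ts {σ} → nth (prefixS 0 S ++ sectorsFrom 0 ts) 1 ≡ just σ → proj₁ σ ≡ [] → S ≡ [] × ts ≢ []
firstSector-atRoot []      (t ∷ ts) _    _  = refl , λ ()
firstSector-atRoot (s ∷ S) ts       refl ()

shiftSector-sameVertex : ∀ σ τ {p i j} → shiftSector σ ≡ (p , i) → shiftSector τ ≡ (p , j) → proj₁ σ ≡ proj₁ τ
shiftSector-sameVertex ([]    , _) ([]    , _) refl refl = refl
shiftSector-sameVertex (_ ∷ _ , _) (_ ∷ _ , _) refl refl = refl

sameVertex-sectorsFrom : ∀ t ts k → AdjacentAtSameVertex (sectorsFrom 0 (t ∷ ts)) (suc k) →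
  (k ≡ 0 × sectors t ≡ [] × ts ≢ []) ⊎ ∃[ k′ ] (k ≡ suc k′) × SameVertex (node (t ∷ ts)) (suc k′)
sameVertex-sectorsFrom t ts k adj = shifted k (subst (λ S → AdjacentAtSameVertex S (suc k)) (sectorsFrom-∷ t ts) adj)
  where
  S = sectors (node (t ∷ ts))
  shifted : ∀ k → AdjacentAtSameVertex (([] , 0) ∷ map shiftSector S) (suc k) →
    (k ≡ 0 × sectors t ≡ [] × ts ≢ []) ⊎ ∃[ k′ ] (k ≡ suc k′) × SameVertex (node (t ∷ ts)) (suc k′)
  shifted zero (p , i , j , refl , e₂) with nth-map-just shiftSector S 1 e₂
  ... | σ , r , shift≡ = inj₁ (refl , firstSector-atRoot (sectors t) ts r (shiftSector-sameVertex σ ([] , 0) shift≡ refl))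
  shifted (suc k′) (p , i , j , e₁ , e₂)
    with nth-map-just shiftSector S (suc k′) e₁ | nth-map-just shiftSector S (suc (suc k′)) e₂
  ... | σ , r₁ , shift≡₁ | τ , r₂ , shift≡₂ =
    inj₂ (k′ , refl , proj₁ σ , proj₂ σ , proj₂ τ , r₁ ,
          trans r₂ (cong (λ q → just (q , proj₂ τ)) (sym (shiftSector-sameVertex σ τ shift≡₁ shift≡₂))))

-- Repeated letters are inserted leaves

++-∷≢[] : ∀ (a : Word) b c → a ++ b ∷ c ≢ []
++-∷≢[] []      b c ()
++-∷≢[] (x ∷ a) b c ()

leavesL-𝒯-node : ∀ m v vs → leaves (𝒯 v) ≡ suc (length v) → All (λ u → leaves (𝒯 u) ≡ suc (length u)) vs →
  leavesL (𝒯 v ∷ map 𝒯 vs) ≡ suc (length (joinOn m v vs))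
leavesL-𝒯-node m v []       lv _          = trans (+-identityʳ _) lv
leavesL-𝒯-node m v (u ∷ us) lv (lu ∷ lus) =
  trans (cong₂ _+_ lv (leavesL-𝒯-node m u us lu lus)) (cong suc (sym (length-++ v)))

leaves-𝒯 : ∀ y → leaves (𝒯 y) ≡ suc (length y)
leaves-𝒯 = 𝒯-induction _ refl λ x xs lv lvs →
  trans (cong leaves (𝒯-unfold x xs))
        (trans (leavesL-𝒯-node (maxW (x ∷ xs)) _ _ lv lvs) (cong (suc ∘ length) (joinOn-splitOn (maxW (x ∷ xs)) (x ∷ xs))))

length-sectors-𝒯 : ∀ y → length (sectors (𝒯 y)) ≡ length y
length-sectors-𝒯 y = suc-injective (trans (suc-length-sectors (𝒯 y)) (leaves-𝒯 y))

sectors-𝒯≡[]⇒[] : ∀ u → sectors (𝒯 u) ≡ [] → u ≡ []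
sectors-𝒯≡[]⇒[] []       _  = refl
sectors-𝒯≡[]⇒[] (x ∷ xs) eq with () ← trans (sym (cong length eq)) (length-sectors-𝒯 (x ∷ xs))

sectorIndex-++-∷ : ∀ v (m : Letter) a → length (sectors (𝒯 v)) + suc (suc (length a)) ≡ suc (length (v ++ m ∷ a))
sectorIndex-++-∷ v m a = begin
  length (sectors (𝒯 v)) + suc (suc (length a)) ≡⟨ cong (_+ _) (length-sectors-𝒯 v) ⟩
  length v + suc (suc (length a))               ≡⟨ +-suc (length v) (suc (length a)) ⟩
  suc (length v + length (m ∷ a))               ≡⟨ cong suc (length-++ v) ⟨
  suc (length (v ++ m ∷ a))                     ∎
  where open ≡-Reasoning

record DuplicateBlocks (m : Letter) (v : Word) (vs : List Word) (a : Word) (b : Letter) (c : Word) : Set where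
  field
    v′       : Word
    vs′      : List Word
    avoids   : Avoids m v′
    avoidsAll : All (Avoids m) vs′
    join≡    : joinOn m v′ vs′ ≡ a ++ b ∷ b ∷ c
    inserted : LeafInsertedAt (𝒯-node v vs) (suc (length a)) (𝒯-node v′ vs′)

DuplicationInserts : Word → Set
DuplicationInserts y = ∀ a b c → y ≡ a ++ b ∷ c → LeafInsertedAt (𝒯 y) (suc (length a)) (𝒯 (a ++ b ∷ b ∷ c))

All-duplicate : {P : Letter → Set} (a : Word) (b : Letter) (c : Word) → All P (a ++ b ∷ c) → All P (a ++ b ∷ b ∷ c)
All-duplicate []      b c (pb ∷ pc) = pb ∷ pb ∷ pc
All-duplicate (x ∷ a) b c (px ∷ p)  = px ∷ All-duplicate a b c p

mutual
  duplicateBlocks : ∀ m v vs → Avoids m v → All (Avoids m) vs → DuplicationInserts v → All DuplicationInserts vs →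
    ∀ a b c → joinOn m v vs ≡ a ++ b ∷ c → DuplicateBlocks m v vs a b c
  duplicateBlocks m v vs nv nvs dv dvs a b c eq
    with ++-∷-split v (joinTail m vs) a c b (trans (sym (joinOn≡++joinTail m v vs)) eq)
  ... | inj₁ (c′ , refl , refl) = record
    { v′        = a ++ b ∷ b ∷ c′
    ; vs′       = vs
    ; avoids    = All-duplicate a b c′ nv
    ; avoidsAll = nvs
    ; join≡     = trans (joinOn≡++joinTail m _ vs) (++-assoc a (b ∷ b ∷ c′) (joinTail m vs))
    ; inserted  = leafInsertedAt-head (map 𝒯 vs) (dv a b c′ refl)
    }
  ... | inj₂ (a′ , refl , eq′) = duplicateTail m v vs nv nvs dvs a′ b c eq′

  duplicateTail : ∀ m v vs → Avoids m v → All (Avoids m) vs → All DuplicationInserts vs →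
    ∀ a′ b c → joinTail m vs ≡ a′ ++ b ∷ c → DuplicateBlocks m v vs (v ++ a′) b c
  duplicateTail m v [] nv nvs dvs a′ b c eq = ⊥-elim (++-∷≢[] a′ b c (sym eq))
  duplicateTail m v (u ∷ us) nv nvs dvs [] b c refl = record
    { v′        = v
    ; vs′       = [] ∷ u ∷ us
    ; avoids    = nv
    ; avoidsAll = [] ∷ nvs
    ; join≡     = cong (_++ m ∷ m ∷ joinOn m u us) (sym (++-identityʳ v))
    ; inserted  = subst (λ n → LeafInsertedAt (𝒯-node v (u ∷ us)) (suc n) (𝒯-node v ([] ∷ u ∷ us)))
                        (trans (length-sectors-𝒯 v) (cong length (sym (++-identityʳ v))))
                        (leafInsertedAt-gap (𝒯 v) (𝒯 u) (map 𝒯 us))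
    }
  duplicateTail m v (u ∷ us) nv (nu ∷ nus) (du ∷ dus) (x ∷ a₃) b c eq with refl ← ∷-injectiveˡ eq = record
    { v′        = v
    ; vs′       = v′ ∷ vs′
    ; avoids    = nv
    ; avoidsAll = avoids ∷ avoidsAll
    ; join≡     = trans (cong (λ z → v ++ m ∷ z) join≡) (sym (++-assoc v (m ∷ a₃) (b ∷ b ∷ c)))
    ; inserted  = subst (λ n → LeafInsertedAt (𝒯-node v (u ∷ us)) n (𝒯-node v (v′ ∷ vs′)))
                        (sectorIndex-++-∷ v m a₃) (leafInsertedAt-tail (𝒯 v) inserted)
    }
    where
    open DuplicateBlocks (duplicateBlocks m u us nu nus du dus a₃ b c (∷-injectiveʳ eq))

𝒯-duplicate : ∀ a b c → LeafInsertedAt (𝒯 (a ++ b ∷ c)) (suc (length a)) (𝒯 (a ++ b ∷ b ∷ c))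
𝒯-duplicate a b c =
  𝒯-induction DuplicationInserts (λ a b c eq → ⊥-elim (++-∷≢[] a b c (sym eq))) step (a ++ b ∷ c) a b c refl
  where
  step : ∀ x xs → DuplicationInserts (proj₁ (maxBlocks (x ∷ xs))) → All DuplicationInserts (proj₂ (maxBlocks (x ∷ xs))) →
    DuplicationInserts (x ∷ xs)
  step x xs dv dvs a b c eq =
    subst₂ (λ T T′ → LeafInsertedAt T (suc (length a)) T′) (sym (𝒯-unfold x xs)) (sym 𝒯-dup) inserted
    where
    M = maxW (x ∷ xs)
    avoidsM = splitOn-avoids M (x ∷ xs)
    open DuplicateBlocks (duplicateBlocks M _ _ (proj₁ avoidsM) (proj₂ avoidsM) dv dvs a b c
                                          (trans (joinOn-splitOn M (x ∷ xs)) eq))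
    𝒯-dup : 𝒯 (a ++ b ∷ b ∷ c) ≡ 𝒯-node v′ vs′
    𝒯-dup = subst (λ z → 𝒯 z ≡ 𝒯-node v′ vs′) join≡
      (𝒯-joinOn M v′ vs′ avoids avoidsAll (λ e → ++-∷≢[] a b (b ∷ c) (trans (sym join≡) e))
        (trans (cong maxW join≡) (trans (maxW-++-∷-∷ a b c) (cong maxW (sym eq)))))

RepeatedAt : Word → ℕ → Set
RepeatedAt y k = ∃[ a ] ∃[ b ] ∃[ c ] (y ≡ a ++ b ∷ b ∷ c) × (suc (length a) ≡ k)

SameVertexRepeats : Word → Set
SameVertexRepeats y = ∀ k → SameVertex (𝒯 y) k → RepeatedAt y k

repeatedAt-++ʳ : ∀ {v k} z → RepeatedAt v k → RepeatedAt (v ++ z) k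
repeatedAt-++ʳ z (a , b , c , refl , ix) = a , b , c ++ z , ++-assoc a (b ∷ b ∷ c) z , ix

repeatedAt-++-∷ : ∀ v m {u k} → RepeatedAt u (suc k) → RepeatedAt (v ++ m ∷ u) (length (sectors (𝒯 v)) + suc (suc k))
repeatedAt-++-∷ v m (a , b , c , refl , refl) =
  v ++ m ∷ a , b , c , sym (++-assoc v (m ∷ a) (b ∷ b ∷ c)) , sym (sectorIndex-++-∷ v m a)

sameVertex⇒repeatedAt-joinOn : ∀ m v vs → SameVertexRepeats v → All SameVertexRepeats vs →
  ∀ k → SameVertex (𝒯-node v vs) k → RepeatedAt (joinOn m v vs) k
sameVertex⇒repeatedAt-joinOn m v vs rv rvs k sv with sameVertex-∷ (𝒯 v) (map 𝒯 vs) k sv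
... | inj₁ sv′ = subst (λ y → RepeatedAt y k) (sym (joinOn≡++joinTail m v vs)) (repeatedAt-++ʳ (joinTail m vs) (rv k sv′))
sameVertex⇒repeatedAt-joinOn m v (u ∷ us) rv (ru ∷ rus) k sv | inj₂ (k′ , refl , adj)
  with sameVertex-sectorsFrom (𝒯 u) (map 𝒯 us) k′ adj
... | inj₂ (k″ , refl , sv″) = repeatedAt-++-∷ v m (sameVertex⇒repeatedAt-joinOn m u us ru rus (suc k″) sv″)
... | inj₁ (refl , noSectors , us≢[]) with sectors-𝒯≡[]⇒[] u noSectors | us
...   | refl | []       = ⊥-elim (us≢[] refl)
...   | refl | u₂ ∷ us₂ = v , m , joinOn m u₂ us₂ , refl ,
  sym (trans (+-suc (length (sectors (𝒯 v))) 0) (cong suc (trans (+-identityʳ _) (length-sectors-𝒯 v))))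

sameVertex⇒repeatedAt : ∀ y k → SameVertex (𝒯 y) k → RepeatedAt y k
sameVertex⇒repeatedAt = 𝒯-induction SameVertexRepeats noSameVertex step
  where
  noSameVertex : SameVertexRepeats []
  noSameVertex zero    (_ , _ , _ , () , _)
  noSameVertex (suc k) (_ , _ , _ , () , _)
  step : ∀ x xs → SameVertexRepeats (proj₁ (maxBlocks (x ∷ xs))) → All SameVertexRepeats (proj₂ (maxBlocks (x ∷ xs))) →
    SameVertexRepeats (x ∷ xs)
  step x xs rv rvs k sv = subst (λ y → RepeatedAt y k) (joinOn-splitOn (maxW (x ∷ xs)) (x ∷ xs))
    (sameVertex⇒repeatedAt-joinOn (maxW (x ∷ xs)) _ _ rv rvs k (subst (λ T → SameVertex T k) (𝒯-unfold x xs) sv))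

𝒯-duplicate-≡⇔ : ∀ a b c a′ b′ c′ → length a ≡ length a′ →
  𝒯 (a ++ b ∷ b ∷ c) ≡ 𝒯 (a′ ++ b′ ∷ b′ ∷ c′) ⇔ 𝒯 (a ++ b ∷ c) ≡ 𝒯 (a′ ++ b′ ∷ c′)
𝒯-duplicate-≡⇔ a b c a′ b′ c′ len = mk⇔
  (λ eq → trans (sym (glue-leafInserted (𝒯-duplicate a b c)))
            (trans (cong₂ glue eq (cong suc len)) (glue-leafInserted (𝒯-duplicate a′ b′ c′))))
  (λ eq → leafInserted-functional (𝒯-duplicate a b c)
            (subst₂ (λ T k → LeafInsertedAt T k (𝒯 (a′ ++ b′ ∷ b′ ∷ c′))) (sym eq) (cong suc (sym len))
                    (𝒯-duplicate a′ b′ c′)))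

repeatedAt⇒sameVertex : ∀ {y k} → RepeatedAt y k → SameVertex (𝒯 y) k
repeatedAt⇒sameVertex (a , b , c , refl , refl) = leafInserted⇒sameVertex (𝒯-duplicate a b c)

-- Booleans and packing

module _ {A B : Set} where

  ⌊⌋-⇔ : A ⇔ B → (a? : Dec A) (b? : Dec B) → ⌊ a? ⌋ ≡ ⌊ b? ⌋
  ⌊⌋-⇔ A⇔B a? b? = trans (isYes≗does a?) (trans (does-⇔ A⇔B a? b?) (sym (isYes≗does b?)))

module _ {A : Set} where

  ⌊⌋-true : (a? : Dec A) → A → ⌊ a? ⌋ ≡ true
  ⌊⌋-true a? a = trans (isYes≗does a?) (dec-true a? a)

  ⌊⌋-false : (a? : Dec A) → ¬ A → ⌊ a? ⌋ ≡ false
  ⌊⌋-false a? ¬a = trans (isYes≗does a?) (dec-false a? ¬a)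

  ⌊⌋-true⁻¹ : (a? : Dec A) → ⌊ a? ⌋ ≡ true → A
  ⌊⌋-true⁻¹ (yes a) _ = a

≡true-⇔⇒≡ : {b b′ : Bool} → (b ≡ true ⇔ b′ ≡ true) → b ≡ b′
≡true-⇔⇒≡ {false} {false} _    = refl
≡true-⇔⇒≡ {false} {true}  b⇔b′ = Equivalence.from b⇔b′ refl
≡true-⇔⇒≡ {true}  {false} b⇔b′ = sym (Equivalence.to b⇔b′ refl)
≡true-⇔⇒≡ {true}  {true}  _    = refl

∧-≡true⇒ʳ : ∀ b {b′} → b ∧ b′ ≡ true → b′ ≡ true
∧-≡true⇒ʳ true eq = eq

mutual
  ==t-sound : ∀ t s → t ==t s ≡ true → t ≡ s
  ==t-sound (node ts) (node ss) eq = cong node (==ts-sound ts ss eq)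

  ==ts-sound : ∀ ts ss → ts ==ts ss ≡ true → ts ≡ ss
  ==ts-sound []       []       _  = refl
  ==ts-sound (t ∷ ts) (s ∷ ss) eq with t ==t s in e
  ... | true = cong₂ _∷_ (==t-sound t s e) (==ts-sound ts ss eq)

mutual
  ==t-refl : ∀ t → t ==t t ≡ true
  ==t-refl (node ts) = ==ts-refl ts

  ==ts-refl : ∀ ts → ts ==ts ts ≡ true
  ==ts-refl []       = refl
  ==ts-refl (t ∷ ts) rewrite ==t-refl t = ==ts-refl ts

==t-⇔ : ∀ {t s t′ s′} → (t ≡ s ⇔ t′ ≡ s′) → (t ==t s) ≡ (t′ ==t s′)
==t-⇔ {t} {s} {t′} {s′} eq⇔ = ≡true-⇔⇒≡ (mk⇔
  (λ e → ≡⇒==t (Equivalence.to eq⇔ (==t-sound t s e)))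
  (λ e → ≡⇒==t (Equivalence.from eq⇔ (==t-sound t′ s′ e))))
  where
  ≡⇒==t : ∀ {t s} → t ≡ s → t ==t s ≡ true
  ≡⇒==t {t} refl = ==t-refl t

rank : Word → Letter → Letter
rank w a = suc (length (filter (λ b → occurs b w Bool.≟ true) (upTo a)))

Any-++-∷-∷⇔ : {P : Letter → Set} (a : Word) (b : Letter) (c : Word) → Any P (a ++ b ∷ b ∷ c) ⇔ Any P (a ++ b ∷ c)
Any-++-∷-∷⇔ {P} a b c = mk⇔ (contract a) (expand a)
  where
  contract : ∀ a → Any P (a ++ b ∷ b ∷ c) → Any P (a ++ b ∷ c)
  contract []      (here p)         = here p
  contract []      (there (here p)) = here p
  contract []      (there (there q)) = there q
  contract (x ∷ a) (here p)         = here p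
  contract (x ∷ a) (there q)        = there (contract a q)
  expand : ∀ a → Any P (a ++ b ∷ c) → Any P (a ++ b ∷ b ∷ c)
  expand []      (here p)  = here p
  expand []      (there q) = there (there q)
  expand (x ∷ a) (here p)  = here p
  expand (x ∷ a) (there q) = there (expand a q)

rank-++-∷-∷ : ∀ a b c → rank (a ++ b ∷ b ∷ c) ≗ rank (a ++ b ∷ c)
rank-++-∷-∷ a b c x = cong (suc ∘ length) (filter-≐ (λ y → occurs y _ Bool.≟ true) (λ y → occurs y _ Bool.≟ true)
  ((λ {y} → trans (sym (occurs≡ y))) , λ {y} → trans (occurs≡ y)) (upTo x))
  where
  occurs≡ : ∀ y → occurs y (a ++ b ∷ b ∷ c) ≡ occurs y (a ++ b ∷ c)
  occurs≡ y = ⌊⌋-⇔ (Any-++-∷-∷⇔ a b c) (any? (y ≟_) _) (any? (y ≟_) _)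

pack-++-∷-∷ : ∀ a b c → let r = rank (a ++ b ∷ c) in
  pack (a ++ b ∷ b ∷ c) ≡ map r a ++ r b ∷ r b ∷ map r c
pack-++-∷-∷ a b c = trans (map-cong (rank-++-∷-∷ a b c) (a ++ b ∷ b ∷ c)) (map-++ _ a (b ∷ b ∷ c))

pack-++-∷ : ∀ a b c → let r = rank (a ++ b ∷ c) in pack (a ++ b ∷ c) ≡ map r a ++ r b ∷ map r c
pack-++-∷ a b c = map-++ _ a (b ∷ c)

map-fixes-++-∷-∷⇔ : ∀ (f : Letter → Letter) a b c →
  map f (a ++ b ∷ b ∷ c) ≡ a ++ b ∷ b ∷ c ⇔ map f (a ++ b ∷ c) ≡ a ++ b ∷ c
map-fixes-++-∷-∷⇔ f a b c = mk⇔ (contract a) (expand a)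
  where
  contract : ∀ a → map f (a ++ b ∷ b ∷ c) ≡ a ++ b ∷ b ∷ c → map f (a ++ b ∷ c) ≡ a ++ b ∷ c
  contract []      eq = cong₂ _∷_ (∷-injectiveˡ eq) (∷-injectiveʳ (∷-injectiveʳ eq))
  contract (x ∷ a) eq = cong₂ _∷_ (∷-injectiveˡ eq) (contract a (∷-injectiveʳ eq))
  expand : ∀ a → map f (a ++ b ∷ c) ≡ a ++ b ∷ c → map f (a ++ b ∷ b ∷ c) ≡ a ++ b ∷ b ∷ c
  expand []      eq = cong₂ _∷_ (∷-injectiveˡ eq) eq
  expand (x ∷ a) eq = cong₂ _∷_ (∷-injectiveˡ eq) (expand a (∷-injectiveʳ eq))

isPacked-++-∷-∷ : ∀ a b c → isPacked (a ++ b ∷ b ∷ c) ≡ isPacked (a ++ b ∷ c)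
isPacked-++-∷-∷ a b c = ⌊⌋-⇔ (mk⇔ (λ e → to (trans (sym pack≡) e)) (λ e → trans pack≡ (from e))) _ _
  where
  open Equivalence (map-fixes-++-∷-∷⇔ (rank (a ++ b ∷ c)) a b c)
  pack≡ : pack (a ++ b ∷ b ∷ c) ≡ map (rank (a ++ b ∷ c)) (a ++ b ∷ b ∷ c)
  pack≡ = map-cong (rank-++-∷-∷ a b c) (a ++ b ∷ b ∷ c)

∈-++-∷⇒∈-++ : ∀ {x u : ℕ} (ys zs : List ℕ) → x ∈ ys ++ u ∷ zs → x ≢ u → x ∈ ys ++ zs
∈-++-∷⇒∈-++ []       zs (here x≡u)  x≢u = ⊥-elim (x≢u x≡u)
∈-++-∷⇒∈-++ []       zs (there x∈)  _   = x∈
∈-++-∷⇒∈-++ (y ∷ ys) zs (here x≡y)  _   = here x≡y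
∈-++-∷⇒∈-++ (y ∷ ys) zs (there x∈)  x≢u = there (∈-++-∷⇒∈-++ ys zs x∈ x≢u)

unique-⊆⇒length≤ : ∀ (U ys : List ℕ) → Unique U → All (_∈ ys) U → length U ≤ length ys
unique-⊆⇒length≤ []      ys _          _          = z≤n
unique-⊆⇒length≤ (u ∷ U) ys (u∉ ∷ uniq) (u∈ ∷ U⊆) with ys₁ , ys₂ , refl ← ∈-∃++ u∈ =
  subst (suc (length U) ≤_) (sym (trans (length-++ ys₁) (+-suc (length ys₁) (length ys₂))))
    (s≤s (subst (length U ≤_) (length-++ ys₁)
      (unique-⊆⇒length≤ U (ys₁ ++ ys₂) uniq
        (All.zipWith (λ (u≢ , x∈) → ∈-++-∷⇒∈-++ ys₁ ys₂ x∈ (u≢ ∘ sym)) (u∉ , U⊆)))))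

-- at most length y distinct letters occur in y, so the ranks are at most length y
pack-bounded : ∀ y → All (_< suc (length y)) (pack y)
pack-bounded y =
  All-map⁺ (All.tabulate λ {a} a∈y → s≤s (unique-⊆⇒length≤ (a ∷ below a) y (unique a) (a∈y ∷ below⊆ a)))
  where
  occurs? = λ b → occurs b y Bool.≟ true
  below : ℕ → List ℕ
  below a = filter occurs? (upTo a)
  unique : ∀ a → Unique (a ∷ below a)
  unique a = All.tabulate (λ b∈ a≡b → <-irrefl (sym a≡b) (∈-upTo⁻ (proj₁ (∈-filter⁻ occurs? {xs = upTo a} b∈))))
             ∷ filter⁺ occurs? (upTo⁺ a)
  below⊆ : ∀ a → All (_∈ y) (below a)
  below⊆ a = All.tabulate (λ {b} b∈ → ⌊⌋-true⁻¹ (any? (b ≟_) y) (proj₂ (∈-filter⁻ occurs? {xs = upTo a} b∈)))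

pack-repeatedAt : ∀ {y k} → RepeatedAt y k → RepeatedAt (pack y) k
pack-repeatedAt (a , b , c , refl , refl) =
  map r a , r b , map r c , pack-++-∷-∷ a b c , cong suc (length-map r a)
  where r = rank (a ++ b ∷ c)

-- Coefficients of d_k and ℳ_T

dWord-just⁻¹ : ∀ k w u → dWord k w ≡ just u →
  ∃[ a ] ∃[ b ] ∃[ c ] (w ≡ a ++ b ∷ b ∷ c) × (u ≡ a ++ b ∷ c) × (suc (length a) ≡ k)
dWord-just⁻¹ (suc zero)    (x ∷ y ∷ v) u eq with x ≟ y
dWord-just⁻¹ (suc zero)    (x ∷ x ∷ v) _ refl | yes refl = [] , x , v , refl , refl , refl
dWord-just⁻¹ (suc (suc k)) (x ∷ w)     u eq with dWord (suc k) w in eq′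
dWord-just⁻¹ (suc (suc k)) (x ∷ w)     _ refl | just v with dWord-just⁻¹ (suc k) w v eq′
... | a , b , c , refl , refl , refl = x ∷ a , b , c , refl , refl , refl

dWord-++-∷-∷ : ∀ a b c → dWord (suc (length a)) (a ++ b ∷ b ∷ c) ≡ just (a ++ b ∷ c)
dWord-++-∷-∷ []      b c with b ≟ b
... | yes _   = refl
... | no  b≢b = ⊥-elim (b≢b refl)
dWord-++-∷-∷ (x ∷ a) b c rewrite dWord-++-∷-∷ a b c = refl

isJust≡⇒≡ : ∀ m v → isJust≡ m v ≡ true → m ≡ just v
isJust≡⇒≡ (just u) v eq = cong just (⌊⌋-true⁻¹ (u ≟w v) eq)

dWord-isJust≡ : ∀ a b c w → isJust≡ (dWord (suc (length a)) w) (a ++ b ∷ c) ≡ ⌊ (a ++ b ∷ b ∷ c) ≟w w ⌋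
dWord-isJust≡ a b c w = ≡true-⇔⇒≡ (mk⇔ contracted expanded)
  where
  contracted : isJust≡ (dWord (suc (length a)) w) (a ++ b ∷ c) ≡ true → ⌊ (a ++ b ∷ b ∷ c) ≟w w ⌋ ≡ true
  contracted eq with dWord-just⁻¹ _ w _ (isJust≡⇒≡ _ _ eq)
  ... | a′ , b′ , c′ , refl , u≡ , ix with refl , refl , refl ← ++-∷-injective a a′ u≡ (suc-injective (sym ix)) =
    ⌊⌋-true (_ ≟w _) refl
  expanded : ⌊ (a ++ b ∷ b ∷ c) ≟w w ⌋ ≡ true → isJust≡ (dWord (suc (length a)) w) (a ++ b ∷ c) ≡ true
  expanded eq with refl ← ⌊⌋-true⁻¹ (_ ≟w w) eq =
    trans (cong (λ m → isJust≡ m (a ++ b ∷ c)) (dWord-++-∷-∷ a b c)) (⌊⌋-true ((a ++ b ∷ c) ≟w _) refl)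

isPackedOfShape : Tree → Word → Bool
isPackedOfShape T u = isPacked u ∧ (𝒯 u ==t T)

isPackedOfShape⇒length : ∀ T u → isPackedOfShape T u ≡ true → length u ≡ leaves T ∸ 1
isPackedOfShape⇒length T u eq =
  cong (_∸ 1) (sym (trans (cong leaves (sym (==t-sound (𝒯 u) T (∧-≡true⇒ʳ (isPacked u) eq)))) (leaves-𝒯 u)))

module Coefficients {c ℓ : Level} (K : Field c ℓ) where

  open Field K using (Carrier; _≈_; 0#; 1#; reflexive)
    renaming (_+_ to _⊕_; +-cong to ⊕-cong; +-assoc to ⊕-assoc; +-identityˡ to ⊕-identityˡ; +-identityʳ to ⊕-identityʳ;
              refl to ≈-refl; sym to ≈-sym; trans to ≈-trans)
  open Series K

  Σ-cong : {A : Set} (xs : List A) {f g : A → Carrier} → (∀ x → f x ≈ g x) → Σ[ xs ] f ≈ Σ[ xs ] g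
  Σ-cong []       f≈g = ≈-refl
  Σ-cong (x ∷ xs) f≈g = ⊕-cong (f≈g x) (Σ-cong xs f≈g)

  Σ-zero-All : {A : Set} (xs : List A) {f : A → Carrier} → All (λ x → f x ≈ 0#) xs → Σ[ xs ] f ≈ 0#
  Σ-zero-All []       []           = ≈-refl
  Σ-zero-All (x ∷ xs) (fx≈0 ∷ f≈0) = ≈-trans (⊕-cong fx≈0 (Σ-zero-All xs f≈0)) (⊕-identityʳ 0#)

  Σ-zero : {A : Set} (xs : List A) {f : A → Carrier} → (∀ x → f x ≈ 0#) → Σ[ xs ] f ≈ 0#
  Σ-zero xs f≈0 = Σ-zero-All xs (All.tabulate λ {x} _ → f≈0 x)

  Σ-++ : {A : Set} (xs ys : List A) {f : A → Carrier} → Σ[ xs ++ ys ] f ≈ Σ[ xs ] f ⊕ Σ[ ys ] f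
  Σ-++ []       ys = ≈-sym (⊕-identityˡ _)
  Σ-++ (x ∷ xs) ys = ≈-trans (⊕-cong ≈-refl (Σ-++ xs ys)) (≈-sym (⊕-assoc _ _ _))

  Σ-map : {A B : Set} (g : A → B) (xs : List A) {f : B → Carrier} → Σ[ map g xs ] f ≡ Σ[ xs ] (f ∘ g)
  Σ-map g []           = refl
  Σ-map g (x ∷ xs) {f} = cong (f (g x) ⊕_) (Σ-map g xs)

  Σ-concatMap : {A B : Set} (h : A → List B) (xs : List A) {f : B → Carrier} →
    Σ[ concatMap h xs ] f ≈ Σ[ xs ] (λ x → Σ[ h x ] f)
  Σ-concatMap h []       = ≈-refl
  Σ-concatMap h (x ∷ xs) = ≈-trans (Σ-++ (h x) _) (⊕-cong ≈-refl (Σ-concatMap h xs))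

  Σ-allWords-suc : ∀ as m {f : Word → Carrier} →
    Σ[ allWords as (suc m) ] f ≈ Σ[ as ] (λ a → Σ[ allWords as m ] (f ∘ (a ∷_)))
  Σ-allWords-suc as m = ≈-trans (Σ-concatMap _ as) (Σ-cong as λ a → reflexive (Σ-map (a ∷_) (allWords as m)))

  Σ-indicator : ∀ (x : Carrier) (L : List ℕ) → Unique L → ∀ {a} → a ∈ L →
    Σ[ L ] (λ b → if ⌊ a ≟ b ⌋ then x else 0#) ≈ x
  Σ-indicator x (a ∷ L) (a∉ ∷ _) (here refl) =
    ≈-trans (⊕-cong (reflexive (cong (if_then x else 0#) (⌊⌋-true (a ≟ a) refl)))
                    (Σ-zero-All L (All.map (λ a≢b → reflexive (cong (if_then x else 0#) (⌊⌋-false (a ≟ _) a≢b))) a∉)))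
            (⊕-identityʳ x)
  Σ-indicator x (b ∷ L) (b∉ ∷ uniq) {a} (there a∈) =
    ≈-trans (⊕-cong (reflexive (cong (if_then x else 0#) (⌊⌋-false (a ≟ b) λ { refl → All.lookup b∉ a∈ refl })))
                    (Σ-indicator x L uniq a∈))
            (⊕-identityˡ x)

  Σ-allWords-indicator : ∀ (x : Carrier) N m (z : Word) → length z ≡ m → All (_< N) z →
    Σ[ allWords (upTo N) m ] (λ u → if ⌊ z ≟w u ⌋ then x else 0#) ≈ x
  Σ-allWords-indicator x N zero    []      _   _          = ⊕-identityʳ x
  Σ-allWords-indicator x N (suc m) (y ∷ z) len (y<N ∷ z<N) =
    ≈-trans (Σ-allWords-suc (upTo N) m)
      (≈-trans (Σ-cong (upTo N) firstLetter) (Σ-indicator x (upTo N) (upTo⁺ N) (∈-upTo⁺ y<N)))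
    where
    firstLetter : ∀ a →
      Σ[ allWords (upTo N) m ] (λ u → if ⌊ (y ∷ z) ≟w (a ∷ u) ⌋ then x else 0#) ≈ (if ⌊ y ≟ a ⌋ then x else 0#)
    firstLetter a = byCases (y ≟ a)
      where
      byCases : (y≟a : Dec (y ≡ a)) →
        Σ[ allWords (upTo N) m ] (λ u → if ⌊ (y ∷ z) ≟w (a ∷ u) ⌋ then x else 0#) ≈ (if ⌊ y≟a ⌋ then x else 0#)
      byCases (yes refl) = ≈-trans (Σ-cong (allWords (upTo N) m) λ u →
                                      reflexive (cong (if_then x else 0#)
                                        (⌊⌋-⇔ (mk⇔ ∷-injectiveʳ (cong (y ∷_))) ((y ∷ z) ≟w (y ∷ u)) (z ≟w u))))
                                   (Σ-allWords-indicator x N m z (suc-injective len) z<N)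
      byCases (no y≢a)   = Σ-zero (allWords (upTo N) m) λ u →
                             reflexive (cong (if_then x else 0#) (⌊⌋-false ((y ∷ z) ≟w (a ∷ u)) (y≢a ∘ ∷-injectiveˡ)))

  candidates : Tree → List Word
  candidates T = allWords (upTo (suc (leaves T ∸ 1))) (leaves T ∸ 1)

  preimages : Word → List Word
  preimages v = allWords (upTo (suc (maxW v))) (suc (length v))

  if-≈0 : ∀ b {x} → x ≈ 0# → (if b then x else 0#) ≈ 0#
  if-≈0 true  x≈0 = x≈0
  if-≈0 false _   = ≈-refl

  ℳ-≈0 : ∀ T y → isPackedOfShape T (pack y) ≡ false → ℳ T y ≈ 0#
  ℳ-≈0 T y notShape = Σ-zero (candidates T) term
    where
    term : ∀ u → (if isPackedOfShape T u then (if ⌊ pack y ≟w u ⌋ then 1# else 0#) else 0#) ≈ 0#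
    term u with pack y ≟w u
    ... | yes refl = reflexive (cong (if_then 1# else 0#) notShape)
    ... | no  _    = if-≈0 (isPackedOfShape T u) ≈-refl

  ℳ-≈1 : ∀ T y → isPackedOfShape T (pack y) ≡ true → ℳ T y ≈ 1#
  ℳ-≈1 T y shape = ≈-trans (Σ-cong (candidates T) term) (Σ-allWords-indicator 1# (suc n) n (pack y) length≡ letters)
    where
    n = leaves T ∸ 1
    length≡ : length (pack y) ≡ n
    length≡ = isPackedOfShape⇒length T (pack y) shape
    letters : All (_< suc n) (pack y)
    letters = subst (λ m → All (_< suc m) (pack y)) (trans (sym (length-map _ y)) length≡) (pack-bounded y)
    term : ∀ u → (if isPackedOfShape T u then (if ⌊ pack y ≟w u ⌋ then 1# else 0#) else 0#)
               ≈ (if ⌊ pack y ≟w u ⌋ then 1# else 0#)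
    term u with pack y ≟w u
    ... | yes refl = reflexive (cong (if_then 1# else 0#) shape)
    ... | no  _    = if-≈0 (isPackedOfShape T u) ≈-refl

  ℳ-cong : ∀ T y T′ y′ → isPackedOfShape T (pack y) ≡ isPackedOfShape T′ (pack y′) → ℳ T y ≈ ℳ T′ y′
  ℳ-cong T y T′ y′ eq with isPackedOfShape T′ (pack y′) in shape′
  ... | true  = ≈-trans (ℳ-≈1 T y eq) (≈-sym (ℳ-≈1 T′ y′ shape′))
  ... | false = ≈-trans (ℳ-≈0 T y eq) (≈-sym (ℳ-≈0 T′ y′ shape′))

  ℳ-≈0-length : ∀ T y → length y ≢ leaves T ∸ 1 → ℳ T y ≈ 0#
  ℳ-≈0-length T y length≢ with isPackedOfShape T (pack y) in shape
  ... | true  = ⊥-elim (length≢ (trans (sym (length-map _ y)) (isPackedOfShape⇒length T (pack y) shape)))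
  ... | false = ℳ-≈0 T y shape

  ℳ-repeatedAt : ∀ T k y → ¬ SameVertex T k → RepeatedAt y k → ℳ T y ≈ 0#
  ℳ-repeatedAt T k y ¬sv rep with isPackedOfShape T (pack y) in shape
  ... | true  = ⊥-elim (¬sv (subst (λ T → SameVertex T k) (==t-sound (𝒯 (pack y)) T (∧-≡true⇒ʳ (isPacked (pack y)) shape))
                                   (repeatedAt⇒sameVertex (pack-repeatedAt rep))))
  ... | false = ℳ-≈0 T y shape

  ℳ-duplicate : ∀ a₀ b₀ c₀ a b c → length a ≡ length a₀ →
    ℳ (𝒯 (a₀ ++ b₀ ∷ b₀ ∷ c₀)) (a ++ b ∷ b ∷ c) ≈ ℳ (𝒯 (a₀ ++ b₀ ∷ c₀)) (a ++ b ∷ c)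
  ℳ-duplicate a₀ b₀ c₀ a b c len =
    ℳ-cong (𝒯 (a₀ ++ b₀ ∷ b₀ ∷ c₀)) (a ++ b ∷ b ∷ c) (𝒯 (a₀ ++ b₀ ∷ c₀)) (a ++ b ∷ c) (begin
    isPackedOfShape (𝒯 (a₀ ++ b₀ ∷ b₀ ∷ c₀)) (pack (a ++ b ∷ b ∷ c))
      ≡⟨ cong (isPackedOfShape _) (pack-++-∷-∷ a b c) ⟩
    isPacked (map r a ++ r b ∷ r b ∷ map r c) ∧ (𝒯 (map r a ++ r b ∷ r b ∷ map r c) ==t 𝒯 (a₀ ++ b₀ ∷ b₀ ∷ c₀))
      ≡⟨ cong₂ _∧_ (isPacked-++-∷-∷ (map r a) (r b) (map r c))
                   (==t-⇔ (𝒯-duplicate-≡⇔ (map r a) (r b) (map r c) a₀ b₀ c₀ (trans (length-map r a) len))) ⟩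
    isPacked (map r a ++ r b ∷ map r c) ∧ (𝒯 (map r a ++ r b ∷ map r c) ==t 𝒯 (a₀ ++ b₀ ∷ c₀))
      ≡⟨ cong (isPackedOfShape _) (pack-++-∷ a b c) ⟨
    isPackedOfShape (𝒯 (a₀ ++ b₀ ∷ c₀)) (pack (a ++ b ∷ c)) ∎)
    where
    open ≡-Reasoning
    r = rank (a ++ b ∷ c)

  if-dec-≡ : ∀ (f : Ser) {x w} (x≟w : Dec (x ≡ w)) → (if ⌊ x≟w ⌋ then f w else 0#) ≈ (if ⌊ x≟w ⌋ then f x else 0#)
  if-dec-≡ f (yes refl) = ≈-refl
  if-dec-≡ f (no _)     = ≈-refl

  d-++-∷ : ∀ f a b c → d (suc (length a)) f (a ++ b ∷ c) ≈ f (a ++ b ∷ b ∷ c)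
  d-++-∷ f a b c = ≈-trans (Σ-cong (preimages (a ++ b ∷ c)) term)
    (Σ-allWords-indicator (f (a ++ b ∷ b ∷ c)) (suc (maxW (a ++ b ∷ c))) _ (a ++ b ∷ b ∷ c)
                          (length-++-∷-∷ a b c) (All-duplicate a b c (All.map s≤s (maxW-ub (a ++ b ∷ c)))))
    where
    term : ∀ w → (if isJust≡ (dWord (suc (length a)) w) (a ++ b ∷ c) then f w else 0#)
               ≈ (if ⌊ (a ++ b ∷ b ∷ c) ≟w w ⌋ then f (a ++ b ∷ b ∷ c) else 0#)
    term w = ≈-trans (reflexive (cong (if_then f w else 0#) (dWord-isJust≡ a b c w))) (if-dec-≡ f ((a ++ b ∷ b ∷ c) ≟w w))

  d-short : ∀ k f v → length v < k → d k f v ≈ 0#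
  d-short k f v short = Σ-zero (preimages v) λ w → reflexive (cong (if_then f w else 0#) (noContraction w))
    where
    noContraction : ∀ w → isJust≡ (dWord k w) v ≡ false
    noContraction w with isJust≡ (dWord k w) v in eq
    ... | false = refl
    ... | true with dWord-just⁻¹ k w v (isJust≡⇒≡ _ _ eq)
    ...   | a , b , c , _ , refl , refl = ⊥-elim (<-irrefl refl (≤-trans short (length-≤-++-∷ a b c)))

  d-ℳ-nonadjacent : ∀ T k → ¬ SameVertex T k → d k (ℳ T) ≈S 0S
  d-ℳ-nonadjacent T k ¬sv v = Σ-zero (preimages v) term
    where
    term : ∀ w → (if isJust≡ (dWord k w) v then ℳ T w else 0#) ≈ 0#
    term w with dWord k w in eq
    ... | nothing = ≈-refl
    ... | just u with a , b , c , w≡ , _ , ix ← dWord-just⁻¹ k w u eq =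
      if-≈0 (isJust≡ (just u) v) (ℳ-repeatedAt T k w ¬sv (a , b , c , w≡ , ix))

  d-ℳ-𝒯-duplicate : ∀ a₀ b₀ c₀ → d (suc (length a₀)) (ℳ (𝒯 (a₀ ++ b₀ ∷ b₀ ∷ c₀))) ≈S ℳ (𝒯 (a₀ ++ b₀ ∷ c₀))
  d-ℳ-𝒯-duplicate a₀ b₀ c₀ v = byLength (suc (length a₀) ℕ.≤? length v)
    where
    T = 𝒯 (a₀ ++ b₀ ∷ b₀ ∷ c₀)
    T′ = 𝒯 (a₀ ++ b₀ ∷ c₀)
    byLength : Dec (suc (length a₀) ≤ length v) → d (suc (length a₀)) (ℳ T) v ≈ ℳ T′ v
    byLength (yes long) with a , b , c , refl , len ← splitAt-∷ (length a₀) v long =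
      ≈-trans (subst (λ n → d (suc n) (ℳ T) v ≈ ℳ T (a ++ b ∷ b ∷ c)) len (d-++-∷ (ℳ T) a b c))
              (ℳ-duplicate a₀ b₀ c₀ a b c len)
    byLength (no ¬long) = ≈-trans (d-short _ (ℳ T) v (≰⇒> ¬long)) (≈-sym (ℳ-≈0-length T′ v λ len →
      ¬long (subst (suc (length a₀) ≤_) (trans (cong (_∸ 1) (sym (leaves-𝒯 (a₀ ++ b₀ ∷ c₀)))) (sym len))
                   (length-≤-++-∷ a₀ b₀ c₀))))

  d-ℳ-adjacent : ∀ w k → SameVertex (𝒯 w) k → d k (ℳ (𝒯 w)) ≈S ℳ (glue (𝒯 w) k)
  d-ℳ-adjacent w k sv v with a , b , c , refl , refl ← sameVertex⇒repeatedAt w k sv =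
    ≈-trans (d-ℳ-𝒯-duplicate a b c v) (reflexive (cong (λ T → ℳ T v) (sym (glue-leafInserted (𝒯-duplicate a b c)))))

theorem5p6 : {c ℓ : Level} (K : Field c ℓ) (w : Word) (k : ℕ) →
    1 ≤ k → k + 1 ≤ length w →
    (¬ SameVertex (𝒯 w) k → Series._≈S_ K (Series.d K k (Series.ℳ K (𝒯 w))) (Series.0S K)) ×
    (SameVertex (𝒯 w) k → Series._≈S_ K (Series.d K k (Series.ℳ K (𝒯 w))) (Series.ℳ K (glue (𝒯 w) k)))
theorem5p6 K w k _ _ = d-ℳ-nonadjacent (𝒯 w) k , d-ℳ-adjacent w k
  where open Coefficients K
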